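{- For $n\ge 2$, $$\frac{9}{5}(n-1)\le g(K_3,K_n)\le 2(n-1).$$
   Context: A complete bipartite subgraph of a graph $G$ is given by two nonempty disjoint vertex sets $X,Y$ of $G$ such that every pair $xy$ with $x\in X,y\in Y$ is an edge of $G$; its edge set is all such pairs. For graphs $G,H$, a block is a set of the form $E(B_1)\times E(B_2)$ where $B_1$ is a complete bipartite subgraph of $G$ and $B_2$ a complete bipartite subgraph of $H$. $g(G,H)$ is the minimum number of blocks needed to partition $E(G)\times E(H)$. $K_m$ denotes the complete graph on $m$ vertices. -}

module Defs where

open import Data.Nat using (ℕ)
open import Data.Fin using (Fin)
open import Data.Fin.Subset using (Subset; _∈_; _∉_; Nonempty)
open import Data.Product using (Σ; _×_; Σ-syntax)
open import Data.Sum using (_⊎_)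
open import Relation.Binary.PropositionalEquality using (_≡_; _≢_)

record Graph : Set₁ where
  field
    V   : ℕ
    Adj : Fin V → Fin V → Set
open Graph public

K : ℕ → Graph
K m = record { V = m ; Adj = λ u v → u ≢ v }

record CompleteBipartite (G : Graph) : Set where
  field
    X Y      : Subset (V G)
    X≠∅      : Nonempty X
    Y≠∅      : Nonempty Y
    disjoint : ∀ v → v ∈ X → v ∉ Y
    complete : ∀ x y → x ∈ X → y ∈ Y → Adj G x y
open CompleteBipartite public

InEdges : {G : Graph} → CompleteBipartite G → Fin (V G) → Fin (V G) → Set
InEdges B u v = (u ∈ X B × v ∈ Y B) ⊎ (u ∈ Y B × v ∈ X B)

-- A block E(B₁) × E(B₂).
Block : Graph → Graph → Set
Block G H = CompleteBipartite G × CompleteBipartite H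

InBlock : {G H : Graph} → Block G H →
          Fin (V G) → Fin (V G) → Fin (V H) → Fin (V H) → Set
InBlock (B₁ Data.Product., B₂) u v u' v' = InEdges B₁ u v × InEdges B₂ u' v'

-- A partition of E(G) × E(H) into k blocks: every pair of edges
-- (e, f) ∈ E(G) × E(H) lies in exactly one of the k blocks.
-- (Blocks are automatically contained in E(G) × E(H).)
BlockPartition : (G H : Graph) → ℕ → Set
BlockPartition G H k =
  Σ[ b ∈ (Fin k → Block G H) ]
    (∀ u v u' v' → Adj G u v → Adj H u' v' →
      Σ[ i ∈ Fin k ] (InBlock (b i) u v u' v' ×
        (∀ j → InBlock (b j) u v u' v' → j ≡ i)))

module Submission where

-- Let the blocks E(Bᵢ) × E(Cᵢ) (i < k) partition E(K₃) × E(Kₙ).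
-- For an edge e of K₃ the Cᵢ with e ∈ E(Bᵢ) partition Kₙ, so the weights
-- wₑ(i) = [e ∈ E(Bᵢ)] form a weighted biclique decomposition of Kₙ
-- (Σᵢ wₑ(i)[uv ∈ E(Cᵢ)] = 1 on every edge uv), and so do the affine
-- combinations w₀₁ + w₀₂ - w₁₂, w₀₁ + w₁₂ - w₀₂, w₀₂ + w₁₂ - w₀₁.  The weighted
-- Graham–Pollak theorem says such a decomposition has at least n - 1 nonzero
-- weights: with fewer, Gaussian elimination yields a nonzero integer x with
-- Σ x = 0 and x(Xᵢ) = 0 for the weighted Cᵢ = (Xᵢ, Yᵢ), and the quadratic form
-- Σ_{u,v} xᵤxᵥ Σᵢ wᵢ[uv ∈ E(Cᵢ)] is then both 0 and -Σ x².  Counting the edge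
-- weights twice and the combinations once gives 9(n - 1) ≤ Σᵢ scoreᵢ, while a
-- biclique of K₃ never contains a triangle, so each block scores at most 5.
--
-- The m stars ({j}, {v > j}) partition K_{m+1}, and products of
-- biclique partitions of G and H are block partitions of E(G) × E(H); the two
-- stars of K₃ times the n - 1 stars of Kₙ give 2(n - 1) blocks.

open import Defs
open import Data.Nat using (ℕ; zero; suc; z≤n; s≤s)
import Data.Nat as ℕ
import Data.Nat.Properties as ℕP
import Data.Nat.Tactic.RingSolver as NS
open import Data.Fin using (Fin; zero; suc; inject₁; fromℕ; lower₁; combine; remQuot)
import Data.Fin as Fin
import Data.Fin.Properties as FP
open import Data.Fin.Properties using (remQuot-combine; combine-remQuot)
open import Data.Fin.Patterns using (0F; 1F; 2F)
open import Data.Fin.Subset using (Subset; _∈_; _∉_; ⁅_⁆; ⊤; outside)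
open import Data.Fin.Subset.Properties using (_∈?_; ∈⊤; x∈⁅x⁆; x∈⁅y⁆⇒x≡y)
open import Data.Vec using (_∷_; lookup; there)
open import Data.Vec.Properties using ([]=⇒lookup; lookup⇒[]=)
open import Data.List using (List; []; _∷_; length; map)
open import Data.List.Properties using (length-map)
open import Data.List.Relation.Unary.All as All using (All; []; _∷_)
open import Data.List.Relation.Unary.All.Properties using (map⁻)
open import Data.Product using (_×_; _,_; proj₁; proj₂; Σ-syntax)
open import Data.Sum using (_⊎_; inj₁; inj₂)
open import Data.Bool using (true; false; if_then_else_)
open import Data.Empty using (⊥; ⊥-elim)
open import Function using (_∘_)
open import Relation.Nullary using (¬_; Dec; yes; no)
open import Relation.Nullary.Decidable using (_×-dec_; _⊎-dec_)
open import Relation.Binary.Definitions using (tri<; tri≈; tri>)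
open import Relation.Binary.PropositionalEquality
import Algebra.Properties.Semiring.Sum ℕP.+-*-semiring as ℕΣ

module _ where
  open import Data.Integer as ℤ using (ℤ; +_; -_; _+_; _*_; _-_; 0ℤ; 1ℤ; -1ℤ; ∣_∣; _≟_)
  import Data.Integer.Properties as ℤP
  open import Data.Integer.Tactic.RingSolver using (solve-∀)
  open import Algebra.Properties.Semiring.Sum ℤP.+-*-semiring
    using (sum; sum-syntax; sum-cong-≗; sum-replicate-zero; ∑-distrib-+; ∑-comm; *-distribˡ-sum)
  open ≡-Reasoning

  Vecℤ : ℕ → Set
  Vecℤ n = Fin n → ℤ

  ∑-zero : ∀ {k} (f : Vecℤ k) → (∀ i → f i ≡ 0ℤ) → sum f ≡ 0ℤ
  ∑-zero {k} f f≡0 = trans (sum-cong-≗ f≡0) (sum-replicate-zero k)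

  ∑-linear : ∀ {k} (c d : ℤ) (f g : Vecℤ k) →
    ∑[ i < k ] (c * f i + d * g i) ≡ c * sum f + d * sum g
  ∑-linear c d f g = begin
    sum (λ i → c * f i + d * g i)            ≡⟨ ∑-distrib-+ (λ i → c * f i) (λ i → d * g i) ⟩
    sum (λ i → c * f i) + sum (λ i → d * g i) ≡⟨ cong₂ _+_ (*-distribˡ-sum c f) (*-distribˡ-sum d g) ⟨
    c * sum f + d * sum g                     ∎

  ∑-single : ∀ {k} (f : Vecℤ k) (i₀ : Fin k) → (∀ i → i ≢ i₀ → f i ≡ 0ℤ) → sum f ≡ f i₀
  ∑-single {suc k} f zero others =
    trans (cong (λ t → f zero + t) (∑-zero (f ∘ suc) (λ i → others (suc i) (λ ())))) (ℤP.+-identityʳ (f zero))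
  ∑-single {suc k} f (suc i₀) others =
    trans (cong (_+ sum (f ∘ suc)) (others zero (λ ())))
          (trans (ℤP.+-identityˡ _)
                 (∑-single (f ∘ suc) i₀ (λ i i≢i₀ → others (suc i) (i≢i₀ ∘ FP.suc-injective))))

  dot : ∀ {n} → Vecℤ n → Vecℤ n → ℤ
  dot a x = ∑[ j < _ ] (a j * x j)

  Solves : ∀ {n} → List (Vecℤ n) → Vecℤ n → Set
  Solves eqs x = All (λ a → dot a x ≡ 0ℤ) eqs

  Nontrivial : ∀ {n} → Vecℤ n → Set
  Nontrivial x = Σ[ j ∈ Fin _ ] x j ≢ 0ℤ

  data PivotSplit {n} : List (Vecℤ (suc n)) → Set where
    no-pivot : ∀ {eqs} → All (λ a → a zero ≡ 0ℤ) eqs → PivotSplit eqs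
    pivot    : ∀ {eqs} (a : Vecℤ (suc n)) (rest : List (Vecℤ (suc n))) →
               a zero ≢ 0ℤ → length eqs ≡ suc (length rest) →
               (∀ x → dot a x ≡ 0ℤ → Solves rest x → Solves eqs x) → PivotSplit eqs

  pivotSplit : ∀ {n} (eqs : List (Vecℤ (suc n))) → PivotSplit eqs
  pivotSplit [] = no-pivot []
  pivotSplit (a ∷ eqs) with a zero ≟ 0ℤ | pivotSplit eqs
  ... | no  a₀≢0 | _          = pivot a eqs a₀≢0 refl (λ x a·x≡0 rest → a·x≡0 ∷ rest)
  ... | yes a₀≡0 | no-pivot z = no-pivot (a₀≡0 ∷ z)
  ... | yes a₀≡0 | pivot p rest p₀≢0 len back =
    pivot p (a ∷ rest) p₀≢0 (cong suc len) (λ { x p·x≡0 (a·x≡0 ∷ s) → a·x≡0 ∷ back x p·x≡0 s })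

  eliminate : ∀ {n} → Vecℤ (suc n) → Vecℤ (suc n) → Vecℤ n
  eliminate a b j = a zero * b (suc j) - b zero * a (suc j)

  -- Back substitution: extends y to a vector x with a · x = 0.
  extend : ∀ {n} → Vecℤ (suc n) → Vecℤ n → Vecℤ (suc n)
  extend a y zero    = - dot (a ∘ suc) y
  extend a y (suc j) = a zero * y j

  -- Both b · (extend a y) and (eliminate a b) · y equal a₀(b'·y) - b₀(a'·y).
  dot-extend : ∀ {n} (a b : Vecℤ (suc n)) y →
    dot b (extend a y) ≡ a zero * dot (b ∘ suc) y - b zero * dot (a ∘ suc) y
  dot-extend {n} a b y = begin
    b zero * (- D) + ∑[ j < n ] (b (suc j) * (a zero * y j))
      ≡⟨ cong (λ t → b zero * (- D) + t) (sum-cong-≗ (λ j → swap (b (suc j)) (a zero) (y j))) ⟩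
    b zero * (- D) + ∑[ j < n ] (a zero * (b (suc j) * y j))
      ≡⟨ cong (λ t → b zero * (- D) + t) (*-distribˡ-sum (a zero) (λ j → b (suc j) * y j)) ⟨
    b zero * (- D) + a zero * E
      ≡⟨ reorder (a zero) (b zero) D E ⟩
    a zero * E - b zero * D ∎
    where
    D E : ℤ
    D = dot (a ∘ suc) y
    E = dot (b ∘ suc) y
    swap : ∀ p q r → p * (q * r) ≡ q * (p * r)
    swap = solve-∀
    reorder : ∀ a₀ b₀ D E → b₀ * (- D) + a₀ * E ≡ a₀ * E - b₀ * D
    reorder = solve-∀

  dot-eliminate : ∀ {n} (a b : Vecℤ (suc n)) y →
    dot (eliminate a b) y ≡ a zero * dot (b ∘ suc) y - b zero * dot (a ∘ suc) y
  dot-eliminate {n} a b y = begin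
    ∑[ j < n ] ((a zero * b (suc j) - b zero * a (suc j)) * y j)
      ≡⟨ sum-cong-≗ (λ j → expand (a zero) (b zero) (a (suc j)) (b (suc j)) (y j)) ⟩
    ∑[ j < n ] (a zero * (b (suc j) * y j) + (- b zero) * (a (suc j) * y j))
      ≡⟨ ∑-linear (a zero) (- b zero) (λ j → b (suc j) * y j) (λ j → a (suc j) * y j) ⟩
    a zero * dot (b ∘ suc) y + (- b zero) * dot (a ∘ suc) y
      ≡⟨ cong (λ t → a zero * dot (b ∘ suc) y + t) (ℤP.neg-distribˡ-* (b zero) _) ⟨
    a zero * dot (b ∘ suc) y - b zero * dot (a ∘ suc) y ∎
    where
    expand : ∀ a₀ b₀ aⱼ bⱼ yⱼ → (a₀ * bⱼ - b₀ * aⱼ) * yⱼ ≡ a₀ * (bⱼ * yⱼ) + (- b₀) * (aⱼ * yⱼ)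
    expand = solve-∀

  e₀ : ∀ {n} → Vecℤ (suc n)
  e₀ zero    = 1ℤ
  e₀ (suc _) = 0ℤ

  dot-e₀ : ∀ {n} (a : Vecℤ (suc n)) → a zero ≡ 0ℤ → dot a e₀ ≡ 0ℤ
  dot-e₀ {n} a a₀≡0 = begin
    a zero * 1ℤ + ∑[ j < n ] (a (suc j) * 0ℤ)
      ≡⟨ cong₂ _+_ (ℤP.*-identityʳ (a zero)) (∑-zero _ (λ j → ℤP.*-zeroʳ (a (suc j)))) ⟩
    a zero + 0ℤ
      ≡⟨ cong (_+ 0ℤ) a₀≡0 ⟩
    0ℤ ∎

  nontrivial-solution : ∀ n (eqs : List (Vecℤ n)) → length eqs ℕ.< n →
    Σ[ x ∈ Vecℤ n ] (Nontrivial x × Solves eqs x)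
  nontrivial-solution (suc n) eqs fewer with pivotSplit eqs
  ... | no-pivot first-column-zero = e₀ , (zero , λ ()) , All.map (λ {a} → dot-e₀ a) first-column-zero
  ... | pivot a rest a₀≢0 len back
      with nontrivial-solution n (map (eliminate a) rest) fewer′
    where
    fewer′ : length (map (eliminate a) rest) ℕ.< n
    fewer′ rewrite length-map (eliminate a) rest = ℕ.s≤s⁻¹ (subst (ℕ._< suc n) len fewer)
  ...   | y , (j , yⱼ≢0) , solves-reduced =
    extend a y , (suc j , product≢0) ,
    back (extend a y) pivot-row (All.map (λ {b} → other-row b) (map⁻ solves-reduced))
    where
    pivot-row : dot a (extend a y) ≡ 0ℤ
    pivot-row = trans (dot-extend a a y) (ℤP.+-inverseʳ (a zero * dot (a ∘ suc) y))
    other-row : ∀ b → dot (eliminate a b) y ≡ 0ℤ → dot b (extend a y) ≡ 0ℤ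
    other-row b = trans (trans (dot-extend a b y) (sym (dot-eliminate a b y)))
    product≢0 : a zero * y j ≢ 0ℤ
    product≢0 a₀yⱼ≡0 with ℤP.i*j≡0⇒i≡0∨j≡0 (a zero) a₀yⱼ≡0
    ... | inj₁ a₀≡0 = a₀≢0 a₀≡0
    ... | inj₂ yⱼ≡0 = yⱼ≢0 yⱼ≡0

  𝟙 : ∀ {n} → Subset n → Vecℤ n
  𝟙 S u = if lookup S u then 1ℤ else 0ℤ

  𝟙-∈ : ∀ {n} {S : Subset n} {u} → u ∈ S → 𝟙 S u ≡ 1ℤ
  𝟙-∈ u∈S rewrite []=⇒lookup u∈S = refl

  𝟙-∉ : ∀ {n} {S : Subset n} {u} → u ∉ S → 𝟙 S u ≡ 0ℤ
  𝟙-∉ {S = S} {u} u∉S with lookup S u in eq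
  ... | true  = ⊥-elim (u∉S (lookup⇒[]= u S eq))
  ... | false = refl

  𝟙-pair-∉ : ∀ {n} {S T : Subset n} {u v} → ¬ (u ∈ S × v ∈ T) → 𝟙 S u * 𝟙 T v ≡ 0ℤ
  𝟙-pair-∉ {S = S} {T} {u} {v} not-both with u ∈? S
  ... | yes u∈S rewrite 𝟙-∉ {S = T} (λ v∈T → not-both (u∈S , v∈T)) = ℤP.*-zeroʳ (𝟙 S u)
  ... | no  u∉S rewrite 𝟙-∉ u∉S = refl

  edgeInd : ∀ {G} → CompleteBipartite G → Fin (V G) → Fin (V G) → ℤ
  edgeInd B u v = 𝟙 (X B) u * 𝟙 (Y B) v + 𝟙 (Y B) u * 𝟙 (X B) v

  InEdges? : ∀ {G} (B : CompleteBipartite G) u v → Dec (InEdges B u v)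
  InEdges? B u v = ((u ∈? X B) ×-dec (v ∈? Y B)) ⊎-dec ((u ∈? Y B) ×-dec (v ∈? X B))

  edgeInd-∈ : ∀ {G} (B : CompleteBipartite G) {u v} → InEdges B u v → edgeInd B u v ≡ 1ℤ
  edgeInd-∈ B (inj₁ (u∈X , v∈Y)) =
    cong₂ _+_ (cong₂ _*_ (𝟙-∈ u∈X) (𝟙-∈ v∈Y))
              (cong₂ _*_ (𝟙-∉ (disjoint B _ u∈X)) (𝟙-∉ (λ v∈X → disjoint B _ v∈X v∈Y)))
  edgeInd-∈ B (inj₂ (u∈Y , v∈X)) =
    cong₂ _+_ (cong₂ _*_ (𝟙-∉ (λ u∈X → disjoint B _ u∈X u∈Y)) (𝟙-∉ (disjoint B _ v∈X)))
              (cong₂ _*_ (𝟙-∈ u∈Y) (𝟙-∈ v∈X))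

  edgeInd-∉ : ∀ {G} (B : CompleteBipartite G) {u v} → ¬ InEdges B u v → edgeInd B u v ≡ 0ℤ
  edgeInd-∉ B ∉E = cong₂ _+_ (𝟙-pair-∉ (∉E ∘ inj₁)) (𝟙-pair-∉ (∉E ∘ inj₂))

  edgeInd-diagonal : ∀ {G} (B : CompleteBipartite G) u → edgeInd B u u ≡ 0ℤ
  edgeInd-diagonal B u = edgeInd-∉ B λ
    { (inj₁ (u∈X , u∈Y)) → disjoint B u u∈X u∈Y
    ; (inj₂ (u∈Y , u∈X)) → disjoint B u u∈X u∈Y }

  biclique-form : ∀ {G} (B : CompleteBipartite G) (x : Vecℤ (V G)) →
    ∑[ u < V G ] ∑[ v < V G ] (x u * x v * edgeInd B u v)
      ≡ dot (𝟙 (Y B)) x * dot (𝟙 (X B)) x + dot (𝟙 (X B)) x * dot (𝟙 (Y B)) x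
  biclique-form {G} B x = begin
    ∑[ u < V G ] ∑[ v < V G ] (x u * x v * edgeInd B u v)
      ≡⟨ sum-cong-≗ (λ u → trans (sum-cong-≗ (λ v → spread (x u) (x v) (𝟙X u) (𝟙Y v) (𝟙Y u) (𝟙X v)))
                                 (∑-linear (x u * 𝟙X u) (x u * 𝟙Y u) (λ v → 𝟙Y v * x v) (λ v → 𝟙X v * x v))) ⟩
    ∑[ u < V G ] (x u * 𝟙X u * xY + x u * 𝟙Y u * xX)
      ≡⟨ sum-cong-≗ (λ u → regroup (x u) (𝟙X u) (𝟙Y u) xY xX) ⟩
    ∑[ u < V G ] (xY * (𝟙X u * x u) + xX * (𝟙Y u * x u))
      ≡⟨ ∑-linear xY xX (λ u → 𝟙X u * x u) (λ u → 𝟙Y u * x u) ⟩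
    xY * xX + xX * xY ∎
    where
    𝟙X 𝟙Y : Vecℤ (V G)
    𝟙X = 𝟙 (X B)
    𝟙Y = 𝟙 (Y B)
    xX xY : ℤ
    xX = dot 𝟙X x
    xY = dot 𝟙Y x
    spread : ∀ xᵤ xᵥ a b c d → xᵤ * xᵥ * (a * b + c * d) ≡ xᵤ * a * (b * xᵥ) + xᵤ * c * (d * xᵥ)
    spread = solve-∀
    regroup : ∀ xᵤ a c p q → xᵤ * a * p + xᵤ * c * q ≡ p * (a * xᵤ) + q * (c * xᵤ)
    regroup = solve-∀

  offDiagonal : ∀ {n} → Fin n → Fin n → ℤ
  offDiagonal zero    zero    = 0ℤ
  offDiagonal zero    (suc _) = 1ℤ
  offDiagonal (suc _) zero    = 1ℤ
  offDiagonal (suc u) (suc v) = offDiagonal u v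

  offDiagonal-≡ : ∀ {n} (u : Fin n) → offDiagonal u u ≡ 0ℤ
  offDiagonal-≡ zero    = refl
  offDiagonal-≡ (suc u) = offDiagonal-≡ u

  offDiagonal-≢ : ∀ {n} {u v : Fin n} → u ≢ v → offDiagonal u v ≡ 1ℤ
  offDiagonal-≢ {u = zero}  {zero}  u≢v = ⊥-elim (u≢v refl)
  offDiagonal-≢ {u = zero}  {suc v} u≢v = refl
  offDiagonal-≢ {u = suc u} {zero}  u≢v = refl
  offDiagonal-≢ {u = suc u} {suc v} u≢v = offDiagonal-≢ (u≢v ∘ cong suc)

  ∑-offDiagonal : ∀ {n} (f : Vecℤ n) (u : Fin n) → ∑[ v < n ] (f v * offDiagonal u v) ≡ sum f - f u
  ∑-offDiagonal {suc n} f zero =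
    trans (cong (λ t → f zero * 0ℤ + t) (sum-cong-≗ (λ v → ℤP.*-identityʳ (f (suc v)))))
          (drop-first (f zero) (sum (f ∘ suc)))
    where
    drop-first : ∀ a S → a * 0ℤ + S ≡ a + S - a
    drop-first = solve-∀
  ∑-offDiagonal {suc n} f (suc u) =
    trans (cong (λ t → f zero * 1ℤ + t) (∑-offDiagonal (f ∘ suc) u))
          (keep-first (f zero) (sum (f ∘ suc)) (f (suc u)))
    where
    keep-first : ∀ a S b → a * 1ℤ + (S - b) ≡ a + S - b
    keep-first = solve-∀

  -- The quadratic form of Kₙ is Σ_{u≠v} xᵤxᵥ = (Σ x)² - Σ x², so it equals
  -- -Σ x² on vectors with Σ x = 0.
  complete-form : ∀ {n} (x : Vecℤ n) → sum x ≡ 0ℤ →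
    ∑[ u < n ] ∑[ v < n ] (x u * x v * offDiagonal u v) ≡ - ∑[ u < n ] (x u * x u)
  complete-form {n} x ∑x≡0 = begin
    ∑[ u < n ] ∑[ v < n ] (x u * x v * offDiagonal u v)
      ≡⟨ sum-cong-≗ (λ u → trans (sum-cong-≗ (λ v → ℤP.*-assoc (x u) (x v) _))
                                 (sym (*-distribˡ-sum (x u) (λ v → x v * offDiagonal u v)))) ⟩
    ∑[ u < n ] (x u * ∑[ v < n ] (x v * offDiagonal u v))
      ≡⟨ sum-cong-≗ (λ u → cong (x u *_) (trans (∑-offDiagonal x u) (cong (_- x u) ∑x≡0))) ⟩
    ∑[ u < n ] (x u * (0ℤ - x u))
      ≡⟨ sum-cong-≗ (λ u → negate (x u)) ⟩
    ∑[ u < n ] (-1ℤ * (x u * x u))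
      ≡⟨ *-distribˡ-sum -1ℤ (λ u → x u * x u) ⟨
    -1ℤ * ∑[ u < n ] (x u * x u)
      ≡⟨ ℤP.-1*i≡-i _ ⟩
    - ∑[ u < n ] (x u * x u) ∎
    where
    negate : ∀ a → a * (0ℤ - a) ≡ -1ℤ * (a * a)
    negate = solve-∀

  square-abs : ∀ i → i * i ≡ + (∣ i ∣ ℕ.* ∣ i ∣)
  square-abs (+ zero)   = refl
  square-abs (+ suc _)  = refl
  square-abs ℤ.-[1+ _ ] = refl

  ∑-squares : ∀ {n} (x : Vecℤ n) → ∑[ u < n ] (x u * x u) ≡ + ℕΣ.sum (λ u → ∣ x u ∣ ℕ.* ∣ x u ∣)
  ∑-squares {zero}  x = refl
  ∑-squares {suc n} x = cong₂ _+_ (square-abs (x zero)) (∑-squares (x ∘ suc))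

  ℕΣ-vanishes : ∀ {n} (f : Fin n → ℕ) → ℕΣ.sum f ≡ 0 → ∀ u → f u ≡ 0
  ℕΣ-vanishes f ∑f≡0 zero    = ℕP.m+n≡0⇒m≡0 (f zero) ∑f≡0
  ℕΣ-vanishes f ∑f≡0 (suc u) = ℕΣ-vanishes (f ∘ suc) (ℕP.m+n≡0⇒n≡0 (f zero) ∑f≡0) u

  squares-vanish : ∀ {n} (x : Vecℤ n) → ∑[ u < n ] (x u * x u) ≡ 0ℤ → ∀ u → x u ≡ 0ℤ
  squares-vanish x ∑x²≡0 u with ℕP.m*n≡0⇒m≡0∨n≡0 ∣ x u ∣ (∣xᵤ∣²≡0 u)
    where
    ∣xᵤ∣²≡0 : ∀ u → ∣ x u ∣ ℕ.* ∣ x u ∣ ≡ 0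
    ∣xᵤ∣²≡0 = ℕΣ-vanishes _ (ℤP.+-injective (trans (sym (∑-squares x)) ∑x²≡0))
  ... | inj₁ ∣xᵤ∣≡0 = ℤP.∣i∣≡0⇒i≡0 ∣xᵤ∣≡0
  ... | inj₂ ∣xᵤ∣≡0 = ℤP.∣i∣≡0⇒i≡0 ∣xᵤ∣≡0

  record WeightedDecomposition (G : Graph) {k : ℕ} (B : Fin k → CompleteBipartite G) (w : Vecℤ k) : Set where
    constructor decomposes
    field covers : ∀ u v → Adj G u v → ∑[ i < k ] (w i * edgeInd (B i) u v) ≡ 1ℤ
  open WeightedDecomposition

  affine : ∀ {k} → Vecℤ k → Vecℤ k → Vecℤ k → Vecℤ k
  affine w₁ w₂ w₃ i = w₁ i + w₂ i - w₃ i

  affine-combination : ∀ {G k} {B : Fin k → CompleteBipartite G} {w₁ w₂ w₃ : Vecℤ k} →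
    WeightedDecomposition G B w₁ → WeightedDecomposition G B w₂ → WeightedDecomposition G B w₃ →
    WeightedDecomposition G B (affine w₁ w₂ w₃)
  affine-combination {G} {k} {B} {w₁} {w₂} {w₃} d₁ d₂ d₃ = decomposes covering
    where
    covering : ∀ u v → Adj G u v → ∑[ i < k ] (affine w₁ w₂ w₃ i * edgeInd (B i) u v) ≡ 1ℤ
    covering u v uv = begin
      ∑[ i < k ] ((w₁ i + w₂ i - w₃ i) * e i)
        ≡⟨ sum-cong-≗ (λ i → distribute (w₁ i) (w₂ i) (w₃ i) (e i)) ⟩
      ∑[ i < k ] (1ℤ * (w₁ i * e i + w₂ i * e i) + -1ℤ * (w₃ i * e i))
        ≡⟨ ∑-linear 1ℤ -1ℤ (λ i → w₁ i * e i + w₂ i * e i) (λ i → w₃ i * e i) ⟩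
      1ℤ * ∑[ i < k ] (w₁ i * e i + w₂ i * e i) + -1ℤ * ∑[ i < k ] (w₃ i * e i)
        ≡⟨ cong (λ s → 1ℤ * s + -1ℤ * ∑[ i < k ] (w₃ i * e i)) (∑-distrib-+ (λ i → w₁ i * e i) (λ i → w₂ i * e i)) ⟩
      1ℤ * (∑[ i < k ] (w₁ i * e i) + ∑[ i < k ] (w₂ i * e i)) + -1ℤ * ∑[ i < k ] (w₃ i * e i)
        ≡⟨ cong₂ (λ s t → 1ℤ * s + -1ℤ * t) (cong₂ _+_ (covers d₁ u v uv) (covers d₂ u v uv)) (covers d₃ u v uv) ⟩
      1ℤ ∎
      where
      e : Vecℤ k
      e i = edgeInd (B i) u v
      distribute : ∀ p q r a → (p + q - r) * a ≡ 1ℤ * (p * a + q * a) + -1ℤ * (r * a)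
      distribute = solve-∀

  decomposition-matrix : ∀ {n k} {B : Fin k → CompleteBipartite (K n)} {w : Vecℤ k} →
    WeightedDecomposition (K n) B w → ∀ u v → ∑[ i < k ] (w i * edgeInd (B i) u v) ≡ offDiagonal u v
  decomposition-matrix {B = B} {w} decomposition u v with u Fin.≟ v
  ... | yes refl = trans (∑-zero _ (λ i → trans (cong (w i *_) (edgeInd-diagonal (B i) u)) (ℤP.*-zeroʳ (w i))))
                         (sym (offDiagonal-≡ u))
  ... | no  u≢v  = trans (covers decomposition u v u≢v) (sym (offDiagonal-≢ u≢v))

  weightedForm : ∀ {G k} → (Fin k → CompleteBipartite G) → Vecℤ k → Vecℤ (V G) → ℤ
  weightedForm {G} {k} B w x = ∑[ u < V G ] ∑[ v < V G ] (x u * x v * ∑[ i < k ] (w i * edgeInd (B i) u v))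

  weightedForm-expand : ∀ {G k} (B : Fin k → CompleteBipartite G) (w : Vecℤ k) x →
    weightedForm B w x ≡ ∑[ i < k ] (w i * ∑[ u < V G ] ∑[ v < V G ] (x u * x v * edgeInd (B i) u v))
  weightedForm-expand {G} {k} B w x = begin
    ∑[ u < V G ] ∑[ v < V G ] (x u * x v * ∑[ i < k ] (w i * e i u v))
      ≡⟨ sum-cong-≗ (λ u → sum-cong-≗ (λ v → trans (*-distribˡ-sum (x u * x v) (λ i → w i * e i u v))
                                                   (sum-cong-≗ (λ i → swap (x u * x v) (w i) (e i u v))))) ⟩
    ∑[ u < V G ] ∑[ v < V G ] ∑[ i < k ] (w i * (x u * x v * e i u v))
      ≡⟨ sum-cong-≗ (λ u → ∑-comm (λ v i → w i * (x u * x v * e i u v))) ⟩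
    ∑[ u < V G ] ∑[ i < k ] ∑[ v < V G ] (w i * (x u * x v * e i u v))
      ≡⟨ ∑-comm (λ u i → ∑[ v < V G ] (w i * (x u * x v * e i u v))) ⟩
    ∑[ i < k ] ∑[ u < V G ] ∑[ v < V G ] (w i * (x u * x v * e i u v))
      ≡⟨ sum-cong-≗ (λ i → trans (*-distribˡ-sum (w i) (λ u → ∑[ v < V G ] (x u * x v * e i u v)))
                                 (sum-cong-≗ (λ u → *-distribˡ-sum (w i) (λ v → x u * x v * e i u v)))) ⟨
    ∑[ i < k ] (w i * ∑[ u < V G ] ∑[ v < V G ] (x u * x v * e i u v)) ∎
    where
    e : Fin k → Fin (V G) → Fin (V G) → ℤ
    e i = edgeInd (B i)
    swap : ∀ p q r → p * (q * r) ≡ q * (p * r)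
    swap = solve-∀

  weightedForm-isotropic : ∀ {G k} (B : Fin k → CompleteBipartite G) (w : Vecℤ k) x →
    (∀ i → w i ≢ 0ℤ → dot (𝟙 (X (B i))) x ≡ 0ℤ) → weightedForm B w x ≡ 0ℤ
  weightedForm-isotropic {G} {k} B w x orthogonal = trans (weightedForm-expand B w x) (∑-zero _ term≡0)
    where
    form : Vecℤ k
    form i = ∑[ u < V G ] ∑[ v < V G ] (x u * x v * edgeInd (B i) u v)
    term≡0 : ∀ i → w i * form i ≡ 0ℤ
    term≡0 i with w i ≟ 0ℤ
    ... | yes wᵢ≡0 = cong (_* form i) wᵢ≡0
    ... | no  wᵢ≢0 = begin
      w i * form i                    ≡⟨ cong (w i *_) (biclique-form (B i) x) ⟩
      w i * (xY * xX + xX * xY)       ≡⟨ cong (λ t → w i * (xY * t + t * xY)) (orthogonal i wᵢ≢0) ⟩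
      w i * (xY * 0ℤ + 0ℤ * xY)       ≡⟨ cong (w i *_) (zero-sum xY) ⟩
      w i * 0ℤ                        ≡⟨ ℤP.*-zeroʳ (w i) ⟩
      0ℤ                              ∎
      where
      xX xY : ℤ
      xX = dot (𝟙 (X (B i))) x
      xY = dot (𝟙 (Y (B i))) x
      zero-sum : ∀ a → a * 0ℤ + 0ℤ * a ≡ 0ℤ
      zero-sum = solve-∀

  weightedForm-complete : ∀ {n k} {B : Fin k → CompleteBipartite (K n)} {w : Vecℤ k} →
    WeightedDecomposition (K n) B w → ∀ x → sum x ≡ 0ℤ → weightedForm B w x ≡ - ∑[ u < n ] (x u * x u)
  weightedForm-complete {n} decomposition x ∑x≡0 =
    trans (sum-cong-≗ {n} (λ u → sum-cong-≗ (λ v → cong (x u * x v *_) (decomposition-matrix decomposition u v))))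
          (complete-form x ∑x≡0)

  ν : ℤ → ℕ
  ν z with z ≟ 0ℤ
  ... | yes _ = 0
  ... | no  _ = 1

  support : ∀ {k} → Vecℤ k → ℕ
  support w = ℕΣ.sum (λ i → ν (w i))

  supportRows : ∀ {k n} → Vecℤ k → (Fin k → Vecℤ n) → List (Vecℤ n)
  supportRows {zero}  w F = []
  supportRows {suc k} w F with w zero ≟ 0ℤ
  ... | yes _ = supportRows (w ∘ suc) (F ∘ suc)
  ... | no  _ = F zero ∷ supportRows (w ∘ suc) (F ∘ suc)

  length-supportRows : ∀ {k n} (w : Vecℤ k) (F : Fin k → Vecℤ n) → length (supportRows w F) ≡ support w
  length-supportRows {zero}  w F = refl
  length-supportRows {suc k} w F with w zero ≟ 0ℤ
  ... | yes _ = length-supportRows (w ∘ suc) (F ∘ suc)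
  ... | no  _ = cong suc (length-supportRows (w ∘ suc) (F ∘ suc))

  supportRows-solved : ∀ {k n} (w : Vecℤ k) (F : Fin k → Vecℤ n) x →
    Solves (supportRows w F) x → ∀ i → w i ≢ 0ℤ → dot (F i) x ≡ 0ℤ
  supportRows-solved {suc k} w F x solves i wᵢ≢0 with w zero ≟ 0ℤ | i | solves
  ... | yes w₀≡0 | zero  | _          = ⊥-elim (wᵢ≢0 w₀≡0)
  ... | yes _    | suc i | s          = supportRows-solved (w ∘ suc) (F ∘ suc) x s i wᵢ≢0
  ... | no  _    | zero  | F₀·x≡0 ∷ _ = F₀·x≡0
  ... | no  _    | suc i | _ ∷ s      = supportRows-solved (w ∘ suc) (F ∘ suc) x s i wᵢ≢0

  𝟏 : ∀ {n} → Vecℤ n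
  𝟏 _ = 1ℤ

  dot-𝟏 : ∀ {n} (x : Vecℤ n) → dot 𝟏 x ≡ sum x
  dot-𝟏 x = sum-cong-≗ (λ u → ℤP.*-identityˡ (x u))

  -- For a weighted decomposition of Kₙ, no nonzero x satisfies Σ x = 0 and
  -- x(Xᵢ) = 0 for every biclique of nonzero weight: at such an x the
  -- weighted form would be both 0 and -Σ x² < 0.
  no-isotropic-vector : ∀ {n k} {B : Fin k → CompleteBipartite (K n)} {w : Vecℤ k} →
    WeightedDecomposition (K n) B w → ∀ x → Nontrivial x → sum x ≡ 0ℤ →
    (∀ i → w i ≢ 0ℤ → dot (𝟙 (X (B i))) x ≡ 0ℤ) → ⊥
  no-isotropic-vector {n} {B = B} {w} decomposition x (j , xⱼ≢0) ∑x≡0 orthogonal =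
    xⱼ≢0 (squares-vanish x ∑x²≡0 j)
    where
    ∑x²≡0 : ∑[ u < n ] (x u * x u) ≡ 0ℤ
    ∑x²≡0 = ℤP.neg-injective (trans (sym (weightedForm-complete decomposition x ∑x≡0))
                                    (weightedForm-isotropic B w x orthogonal))

  -- Weighted Graham–Pollak theorem: a weighted biclique decomposition of Kₙ
  -- has at least n - 1 nonzero weights, for otherwise the n - 1 or fewer
  -- equations 𝟏 · x = 0 and 𝟙_{Xᵢ} · x = 0 (wᵢ ≠ 0) have a nonzero solution.
  graham-pollak : ∀ {n k} (B : Fin k → CompleteBipartite (K n)) (w : Vecℤ k) →
    WeightedDecomposition (K n) B w → n ℕ.∸ 1 ℕ.≤ support w
  graham-pollak {n} B w decomposition with suc (support w) ℕ.<? n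
  ... | no  n≤1+support = ℕP.∸-monoˡ-≤ 1 (ℕP.≮⇒≥ n≤1+support)
  ... | yes fewer
      with nontrivial-solution n (𝟏 ∷ supportRows w (𝟙 ∘ X ∘ B))
             (subst (λ t → suc t ℕ.< n) (sym (length-supportRows w (𝟙 ∘ X ∘ B))) fewer)
  ...   | x , nontrivial , (𝟏·x≡0 ∷ solves-rows) =
    ⊥-elim (no-isotropic-vector decomposition x nontrivial (trans (sym (dot-𝟏 x)) 𝟏·x≡0)
                                (supportRows-solved w (𝟙 ∘ X ∘ B) x solves-rows))

  sliceWeight : ∀ {G H k} → (Fin k → Block G H) → Fin (V G) → Fin (V G) → Vecℤ k
  sliceWeight b a c i = edgeInd (proj₁ (b i)) a c

  edgeInd-pair-∉ : ∀ {G H} (B : CompleteBipartite G) (C : CompleteBipartite H) {a c u v} →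
    ¬ (InEdges B a c × InEdges C u v) → edgeInd B a c * edgeInd C u v ≡ 0ℤ
  edgeInd-pair-∉ B C {a} {c} {u} {v} not-both with InEdges? B a c
  ... | yes ac∈B = trans (cong (edgeInd B a c *_) (edgeInd-∉ C (λ uv∈C → not-both (ac∈B , uv∈C))))
                         (ℤP.*-zeroʳ (edgeInd B a c))
  ... | no  ac∉B = cong (_* edgeInd C u v) (edgeInd-∉ B ac∉B)

  -- The blocks whose first factor contains the edge ac partition E(H), so
  -- their second factors form a 0/1-weighted decomposition of H.
  slice-decomposition : ∀ {G H k} (P : BlockPartition G H k) {a c} → Adj G a c →
    WeightedDecomposition H (λ i → proj₂ (proj₁ P i)) (sliceWeight (proj₁ P) a c)
  slice-decomposition {H = H} {k} (b , partition) {a} {c} ac = decomposes covering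
    where
    covering : ∀ u v → Adj H u v → ∑[ i < k ] (sliceWeight b a c i * edgeInd (proj₂ (b i)) u v) ≡ 1ℤ
    covering u v uv with partition a c u v ac uv
    ... | i₀ , (ac∈B₁ , uv∈B₂) , unique =
      trans (∑-single _ i₀ other-block≡0)
            (cong₂ _*_ (edgeInd-∈ (proj₁ (b i₀)) ac∈B₁) (edgeInd-∈ (proj₂ (b i₀)) uv∈B₂))
      where
      other-block≡0 : ∀ i → i ≢ i₀ → sliceWeight b a c i * edgeInd (proj₂ (b i)) u v ≡ 0ℤ
      other-block≡0 i i≢i₀ = edgeInd-pair-∉ (proj₁ (b i)) (proj₂ (b i)) (i≢i₀ ∘ unique i)

  triangle-free : ∀ {G} (B : CompleteBipartite G) {a b c} →
    InEdges B a b → InEdges B a c → InEdges B b c → ⊥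
  triangle-free B (inj₁ (_ , b∈Y))   (inj₁ _)          (inj₁ (b∈X , _))   = disjoint B _ b∈X b∈Y
  triangle-free B (inj₁ _)           (inj₁ (_ , c∈Y))  (inj₂ (_ , c∈X))   = disjoint B _ c∈X c∈Y
  triangle-free B (inj₁ (a∈X , _))   (inj₂ (a∈Y , _))  _                  = disjoint B _ a∈X a∈Y
  triangle-free B (inj₂ (a∈Y , _))   (inj₁ (a∈X , _))  _                  = disjoint B _ a∈X a∈Y
  triangle-free B (inj₂ _)           (inj₂ (_ , c∈X))  (inj₁ (_ , c∈Y))   = disjoint B _ c∈X c∈Y
  triangle-free B (inj₂ (_ , b∈X))   (inj₂ _)          (inj₂ (b∈Y , _))   = disjoint B _ b∈X b∈Y

  edgeInd-bit : ∀ {G} (B : CompleteBipartite G) u v → edgeInd B u v ≡ 0ℤ ⊎ edgeInd B u v ≡ 1ℤ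
  edgeInd-bit B u v with InEdges? B u v
  ... | yes uv∈B = inj₂ (edgeInd-∈ B uv∈B)
  ... | no  uv∉B = inj₁ (edgeInd-∉ B uv∉B)

  edgeInd-1⇒∈ : ∀ {G} (B : CompleteBipartite G) {u v} → edgeInd B u v ≡ 1ℤ → InEdges B u v
  edgeInd-1⇒∈ B {u} {v} ≡1 with InEdges? B u v
  ... | yes uv∈B = uv∈B
  ... | no  uv∉B with trans (sym ≡1) (edgeInd-∉ B uv∉B)
  ...   | ()

  -- What one block contributes to the count of the lower bound: its three
  -- edge weights p, q, r (counted twice) and their three affine combinations.
  blockScore : ℤ → ℤ → ℤ → ℕ
  blockScore p q r = 2 ℕ.* (ν p ℕ.+ ν q ℕ.+ ν r) ℕ.+ (ν (p + q - r) ℕ.+ ν (p + r - q) ℕ.+ ν (q + r - p))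

  blockScore-bits≤5 : ∀ {p q r} → p ≡ 0ℤ ⊎ p ≡ 1ℤ → q ≡ 0ℤ ⊎ q ≡ 1ℤ → r ≡ 0ℤ ⊎ r ≡ 1ℤ →
    ¬ (p ≡ 1ℤ × q ≡ 1ℤ × r ≡ 1ℤ) → blockScore p q r ℕ.≤ 5
  blockScore-bits≤5 (inj₁ refl) (inj₁ refl) (inj₁ refl) _ = z≤n
  blockScore-bits≤5 (inj₁ refl) (inj₁ refl) (inj₂ refl) _ = ℕP.≤-refl
  blockScore-bits≤5 (inj₁ refl) (inj₂ refl) (inj₁ refl) _ = ℕP.≤-refl
  blockScore-bits≤5 (inj₁ refl) (inj₂ refl) (inj₂ refl) _ = ℕP.≤-refl
  blockScore-bits≤5 (inj₂ refl) (inj₁ refl) (inj₁ refl) _ = ℕP.≤-refl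
  blockScore-bits≤5 (inj₂ refl) (inj₁ refl) (inj₂ refl) _ = ℕP.≤-refl
  blockScore-bits≤5 (inj₂ refl) (inj₂ refl) (inj₁ refl) _ = ℕP.≤-refl
  blockScore-bits≤5 (inj₂ refl) (inj₂ refl) (inj₂ refl) not-all = ⊥-elim (not-all (refl , refl , refl))

  -- Since a biclique has no triangle, every block scores at most 5 on a triangle abc.
  blockScore≤5 : ∀ {G} (B : CompleteBipartite G) a b c →
    blockScore (edgeInd B a b) (edgeInd B a c) (edgeInd B b c) ℕ.≤ 5
  blockScore≤5 B a b c = blockScore-bits≤5 (edgeInd-bit B a b) (edgeInd-bit B a c) (edgeInd-bit B b c)
    (λ (ab , ac , bc) → triangle-free B (edgeInd-1⇒∈ B ab) (edgeInd-1⇒∈ B ac) (edgeInd-1⇒∈ B bc))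

open import Data.Nat using (_+_; _*_; _≤_; _∸_)

∑-≤ : ∀ {k} (f : Fin k → ℕ) c → (∀ i → f i ≤ c) → ℕΣ.sum f ≤ k * c
∑-≤ {zero}  f c _   = z≤n
∑-≤ {suc k} f c f≤c = ℕP.+-mono-≤ (f≤c zero) (∑-≤ (f ∘ suc) c (f≤c ∘ suc))

∑-+₃ : ∀ {k} (f g h : Fin k → ℕ) → ℕΣ.sum (λ i → f i + g i + h i) ≡ ℕΣ.sum f + ℕΣ.sum g + ℕΣ.sum h
∑-+₃ f g h = trans (ℕΣ.∑-distrib-+ (λ i → f i + g i) h) (cong (_+ ℕΣ.sum h) (ℕΣ.∑-distrib-+ f g))

∑-blockScore : ∀ {k} (p q r : Vecℤ k) →
  ℕΣ.sum (λ i → blockScore (p i) (q i) (r i))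
    ≡ 2 * (support p + support q + support r) + (support (affine p q r) + support (affine p r q) + support (affine q r p))
∑-blockScore {k} p q r = begin
  ℕΣ.sum (λ i → 2 * edges i + combinations i)
    ≡⟨ ℕΣ.∑-distrib-+ (λ i → 2 * edges i) combinations ⟩
  ℕΣ.sum (λ i → 2 * edges i) + ℕΣ.sum combinations
    ≡⟨ cong (_+ ℕΣ.sum combinations) (ℕΣ.*-distribˡ-sum 2 edges) ⟨
  2 * ℕΣ.sum edges + ℕΣ.sum combinations
    ≡⟨ cong₂ (λ s t → 2 * s + t) (∑-+₃ (ν ∘ p) (ν ∘ q) (ν ∘ r))
                                 (∑-+₃ (ν ∘ affine p q r) (ν ∘ affine p r q) (ν ∘ affine q r p)) ⟩
  2 * (support p + support q + support r)
    + (support (affine p q r) + support (affine p r q) + support (affine q r p)) ∎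
  where
  open ≡-Reasoning
  edges combinations : Fin k → ℕ
  edges i = ν (p i) + ν (q i) + ν (r i)
  combinations i = ν (affine p q r i) + ν (affine p r q i) + ν (affine q r p i)

lower-bound : ∀ n k → BlockPartition (K 3) (K n) k → 9 * (n ∸ 1) ≤ 5 * k
lower-bound n k P@(b , _) = begin
  9 * (n ∸ 1)                                   ≡⟨ nine (n ∸ 1) ⟩
  2 * (n ∸ 1 + (n ∸ 1) + (n ∸ 1)) + (n ∸ 1 + (n ∸ 1) + (n ∸ 1))
    ≤⟨ ℕP.+-mono-≤ (ℕP.*-monoʳ-≤ 2 (sum₃ (gp d₀₁) (gp d₀₂) (gp d₁₂)))
                   (sum₃ (gp (affine-combination d₀₁ d₀₂ d₁₂)) (gp (affine-combination d₀₁ d₁₂ d₀₂))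
                         (gp (affine-combination d₀₂ d₁₂ d₀₁))) ⟩
  2 * (support w₀₁ + support w₀₂ + support w₁₂)
    + (support (affine w₀₁ w₀₂ w₁₂) + support (affine w₀₁ w₁₂ w₀₂) + support (affine w₀₂ w₁₂ w₀₁))
    ≡⟨ ∑-blockScore w₀₁ w₀₂ w₁₂ ⟨
  ℕΣ.sum (λ i → blockScore (w₀₁ i) (w₀₂ i) (w₁₂ i)) ≤⟨ ∑-≤ _ 5 (λ i → blockScore≤5 (proj₁ (b i)) 0F 1F 2F) ⟩
  k * 5                                         ≡⟨ ℕP.*-comm k 5 ⟩
  5 * k                                         ∎
  where
  open ℕP.≤-Reasoning
  w₀₁ w₀₂ w₁₂ : Vecℤ k
  w₀₁ = sliceWeight b 0F 1F
  w₀₂ = sliceWeight b 0F 2F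
  w₁₂ = sliceWeight b 1F 2F
  B₂ : Fin k → CompleteBipartite (K n)
  B₂ i = proj₂ (b i)
  d₀₁ : WeightedDecomposition (K n) B₂ w₀₁
  d₀₂ : WeightedDecomposition (K n) B₂ w₀₂
  d₁₂ : WeightedDecomposition (K n) B₂ w₁₂
  d₀₁ = slice-decomposition P {0F} {1F} (λ ())
  d₀₂ = slice-decomposition P {0F} {2F} (λ ())
  d₁₂ = slice-decomposition P {1F} {2F} (λ ())
  gp : ∀ {w} → WeightedDecomposition (K n) B₂ w → n ∸ 1 ≤ support w
  gp = graham-pollak B₂ _
  sum₃ : ∀ {a b c a′ b′ c′} → a ≤ a′ → b ≤ b′ → c ≤ c′ → a + b + c ≤ a′ + b′ + c′
  sum₃ a≤ b≤ c≤ = ℕP.+-mono-≤ (ℕP.+-mono-≤ a≤ b≤) c≤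
  nine : ∀ t → 9 * t ≡ 2 * (t + t + t) + (t + t + t)
  nine = NS.solve-∀

BicliquePartition : Graph → ℕ → Set
BicliquePartition G p = Σ[ B ∈ (Fin p → CompleteBipartite G) ]
  (∀ u v → Adj G u v → Σ[ i ∈ Fin p ] (InEdges (B i) u v × (∀ j → InEdges (B j) u v → j ≡ i)))

product-partition : ∀ {G H p q} → BicliquePartition G p → BicliquePartition H q → BlockPartition G H (p * q)
product-partition {G} {H} {p} {q} (B , partitionB) (C , partitionC) = block , covering
  where
  blockAt : Fin p × Fin q → Block G H
  blockAt (i , j) = B i , C j
  block : Fin (p * q) → Block G H
  block l = blockAt (remQuot q l)
  covering : ∀ u v u′ v′ → Adj G u v → Adj H u′ v′ →
    Σ[ l ∈ Fin (p * q) ] (InBlock (block l) u v u′ v′ × (∀ l′ → InBlock (block l′) u v u′ v′ → l′ ≡ l))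
  covering u v u′ v′ uv u′v′ with partitionB u v uv | partitionC u′ v′ u′v′
  ... | i , uv∈Bᵢ , uniqueB | j , u′v′∈Cⱼ , uniqueC = combine i j , in-block , unique
    where
    in-block : InBlock (block (combine i j)) u v u′ v′
    in-block = subst (λ ij → InBlock (blockAt ij) u v u′ v′) (sym (remQuot-combine i j)) (uv∈Bᵢ , u′v′∈Cⱼ)
    unique : ∀ l → InBlock (block l) u v u′ v′ → l ≡ combine i j
    unique l (uv∈B , u′v′∈C) =
      trans (sym (combine-remQuot {p} q l)) (cong₂ combine (uniqueB _ uv∈B) (uniqueC _ u′v′∈C))

above : ∀ {n} → Fin n → Subset n
above zero    = outside ∷ ⊤
above (suc i) = outside ∷ above i

above⇒> : ∀ {n} {i v : Fin n} → v ∈ above i → i Fin.< v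
above⇒> {i = zero}  {suc v} (there _)    = s≤s z≤n
above⇒> {i = suc i} {suc v} (there v∈Y)  = s≤s (above⇒> v∈Y)

>⇒above : ∀ {n} {i v : Fin n} → i Fin.< v → v ∈ above i
>⇒above {i = zero}  {suc v} _          = there ∈⊤
>⇒above {i = suc i} {suc v} (s≤s i<v)  = there (>⇒above i<v)

star : ∀ {m} → Fin m → CompleteBipartite (K (suc m))
star {m} j = record
  { X        = ⁅ inject₁ j ⁆
  ; Y        = above (inject₁ j)
  ; X≠∅      = inject₁ j , x∈⁅x⁆ (inject₁ j)
  ; Y≠∅      = fromℕ m , >⇒above (subst₂ ℕ._<_ (sym (FP.toℕ-inject₁ j)) (sym (FP.toℕ-fromℕ m)) (FP.toℕ<n j))
  ; disjoint = λ v v∈X v∈Y → FP.<-irrefl (sym (x∈⁅y⁆⇒x≡y _ v∈X)) (above⇒> v∈Y)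
  ; complete = λ u v u∈X v∈Y u≡v → FP.<-irrefl (trans (sym (x∈⁅y⁆⇒x≡y _ u∈X)) u≡v) (above⇒> v∈Y)
  }

star-edge : ∀ {m} {j : Fin m} {u v} → InEdges (star j) u v →
  (u ≡ inject₁ j × u Fin.< v) ⊎ (v ≡ inject₁ j × v Fin.< u)
star-edge (inj₁ (u∈X , v∈Y)) with x∈⁅y⁆⇒x≡y _ u∈X
... | refl = inj₁ (refl , above⇒> v∈Y)
star-edge (inj₂ (u∈Y , v∈X)) with x∈⁅y⁆⇒x≡y _ v∈X
... | refl = inj₂ (refl , above⇒> u∈Y)

-- The stars partition K_{m+1}: the edge uv with u < v lies in the star centred at u only.
star-partition : ∀ m → BicliquePartition (K (suc m)) m
star-partition m = star , covering
  where
  centre : ∀ {u v : Fin (suc m)} → u Fin.< v → Σ[ j ∈ Fin m ] inject₁ j ≡ u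
  centre {u} {v} u<v = lower₁ u m≢u , FP.inject₁-lower₁ u m≢u
    where
    m≢u : m ≢ Fin.toℕ u
    m≢u m≡u = ℕP.<⇒≱ u<v (subst (Fin.toℕ v ≤_) m≡u (FP.toℕ≤pred[n] v))
  unique : ∀ {u v} {j : Fin m} → InEdges (star j) u v → ∀ i → InEdges (star i) u v → i ≡ j
  unique uv∈Sⱼ i uv∈Sᵢ with star-edge uv∈Sⱼ | star-edge uv∈Sᵢ
  ... | inj₁ (u≡j , _)   | inj₁ (u≡i , _)   = FP.inject₁-injective (trans (sym u≡i) u≡j)
  ... | inj₂ (v≡j , _)   | inj₂ (v≡i , _)   = FP.inject₁-injective (trans (sym v≡i) v≡j)
  ... | inj₁ (_ , u<v)   | inj₂ (_ , v<u)   = ⊥-elim (FP.<-asym u<v v<u)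
  ... | inj₂ (_ , v<u)   | inj₁ (_ , u<v)   = ⊥-elim (FP.<-asym u<v v<u)
  covering : ∀ u v → u ≢ v → Σ[ j ∈ Fin m ] (InEdges (star j) u v × (∀ i → InEdges (star i) u v → i ≡ j))
  covering u v u≢v with FP.<-cmp u v
  ... | tri< u<v _ _ with centre u<v
  ...   | j , refl = j , inj₁ (x∈⁅x⁆ _ , >⇒above u<v) , unique (inj₁ (x∈⁅x⁆ _ , >⇒above u<v))
  covering u v u≢v | tri≈ _ u≡v _ = ⊥-elim (u≢v u≡v)
  covering u v u≢v | tri> _ _ v<u with centre v<u
  ...   | j , refl = j , inj₂ (>⇒above v<u , x∈⁅x⁆ _) , unique (inj₂ (>⇒above v<u , x∈⁅x⁆ _))

upper-bound : ∀ m → BlockPartition (K 3) (K (suc m)) (2 * m)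
upper-bound m = product-partition (star-partition 2) (star-partition m)

proposition3 : (n : ℕ) → 2 ≤ n →
    (∀ k → BlockPartition (K 3) (K n) k → 9 * (n ∸ 1) ≤ 5 * k)
    × (Σ[ k ∈ ℕ ] (k ≤ 2 * (n ∸ 1) × BlockPartition (K 3) (K n) k))
proposition3 (suc m) _ = lower-bound (suc m) , (2 * m , ℕP.≤-refl , upper-bound m)
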